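{- Let $s$ be a prime, let $\varphi$ be a $d$-dimensional square morphism of size $s$ over a finite alphabet $A$, prolongable on $a\in A$, let $\mathbf{q}$ be a direction and let $C=\langle\mathbf{q}\bmod s\rangle\subseteq(\mathbb{Z}/s\mathbb{Z})^d$. Suppose that $\varphi(b)_{\mathbf{i}}\neq a$ for every $b\in A$ and every $\mathbf{i}\in C$ with $(b,\mathbf{i})\ne(a,\mathbf{0})$ (while $\varphi(a)_{\mathbf{0}}=a$). Then the one-dimensional word $(\varphi^\omega(a)_{\ell\mathbf{q}})_{\ell\in\mathbb{N}}$ belongs to $a(A\setminus\{a\})^\omega$. In particular, $\varphi^\omega(a)$ is not recurrent along the direction $\mathbf{q}$.
   Context: $\mathbb{N}=\{0,1,\ldots\}$. A $d$-dimensional square morphism of size $s$ maps each $c\in A$ to a block $\varphi(c)\colon\{0,\ldots,s-1\}^d\to A$, written $\varphi(c)_{\mathbf{i}}$, positions being identified with $(\mathbb{Z}/s\mathbb{Z})^d$. Iterates: $\varphi^n(c)(\mathbf{i})=\varphi(\varphi^{n-1}(c)(\mathbf{q}'))(\mathbf{r})$ with $\mathbf{i}=s\mathbf{q}'+\mathbf{r}$ componentwise. Prolongable on $a$: $\varphi(a)_{\mathbf{0}}=a$; $\varphi^\omega(a)$ is the limit fixed point, written $\varphi^\omega(a)_{\mathbf{j}}$ at position $\mathbf{j}$. $\langle\mathbf{x}\rangle=\{k\mathbf{x}:k\in\mathbb{Z}/s\mathbb{Z}\}$. A direction is $\mathbf{q}\in\mathbb{N}^d$ with coprime nonnegative entries;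 "not recurrent along $\mathbf{q}$" means the one-dimensional word $(\varphi^\omega(a)_{\ell\mathbf{q}})_{\ell}$ is not recurrent (some prefix, here its first letter, occurs only once). -}

module Defs where

open import Data.Nat using (ℕ; zero; suc; _+_; _*_; _<_; NonZero)
open import Data.Nat.DivMod using (_/_; _%_; _mod_)
open import Data.Nat.GCD using (gcd)
open import Data.Fin using (Fin; toℕ)
open import Data.List using (List; foldr)
open import Data.Product using (Σ; ∃; _×_)
open import Relation.Binary.PropositionalEquality using (_≡_)
open import Relation.Nullary using (¬_)
import Data.Vec.Functional as VF

-- A d-dimensional square morphism of size s over alphabet A:
-- each letter c is sent to a block {0,…,s-1}^d → A.
SquareMorphism : (A : Set) (d s : ℕ) → Set
SquareMorphism A d s = A → (Fin d → Fin s) → A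

Point : ℕ → Set
Point d = Fin d → ℕ

-- Iterates: φ^0(c)(i) = c, φ^{n+1}(c)(i) = φ(φ^n(c)(q'))(r) with i = s q' + r
-- componentwise.  (Meaningful for i ∈ {0,…,s^n-1}^d; elsewhere it is just the
-- same recursion.)
iter : ∀ {A : Set} {d s : ℕ} .{{_ : NonZero s}} →
       SquareMorphism A d s → ℕ → A → Point d → A
iter φ zero    c i = c
iter {s = s} φ (suc n) c i = φ (iter φ n c (λ j → i j / s)) (λ j → i j mod s)

-- Sum of coordinates; s^(1+sum) exceeds every coordinate when s ≥ 2.
coordSum : ∀ {d} → Point d → ℕ
coordSum {d} i = VF.foldr _+_ 0 i

-- The fixed point φ^ω(a), evaluated at position j: it equals φ^n(a)_j for any n
-- with all coordinates of j below s^n (when φ is prolongable on a); we take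
-- n = 1 + (sum of the coordinates of j).
phiOmega : ∀ {A : Set} {d s : ℕ} .{{_ : NonZero s}} →
           SquareMorphism A d s → A → Point d → A
phiOmega φ a j = iter φ (suc (coordSum j)) a j

gcdAll : ∀ {d} → Point d → ℕ
gcdAll q = VF.foldr gcd 0 q

IsDirection : ∀ {d} → Point d → Set
IsDirection q = gcdAll q ≡ 1

InCyclic : ∀ {d s} .{{_ : NonZero s}} → Point d → (Fin d → Fin s) → Set
InCyclic {s = s} q i = Σ (Fin s) λ k → ∀ j → toℕ (i j) ≡ (toℕ k * q j) % s

IsZeroPos : ∀ {d s} → (Fin d → Fin s) → Set
IsZeroPos i = ∀ j → toℕ (i j) ≡ 0

Recurrent : ∀ {A : Set} → (ℕ → A) → Set
Recurrent w = ∀ n → ∃ λ m → (0 < m) × (∀ i → i < n → w (m + i) ≡ w i)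

module Submission where

open import Defs
open import Data.Nat using (ℕ; zero; suc; _*_; _<_; NonZero)
open import Data.Nat.Primality using (Prime)
open import Data.Fin using (Fin)
open import Data.Product using (_×_; Σ)
open import Data.Sum using (_⊎_)
open import Relation.Binary.PropositionalEquality using (_≡_; _≢_)
open import Relation.Nullary using (¬_)

open import Data.Nat using (_≤_; _^_; z≤n; s≤s; z<s)
open import Data.Nat.Base using (NonTrivial; nonTrivial⇒≢1; nonTrivial⇒n>1; >-nonZero; >-nonZero⁻¹; ≢-nonZero)
open import Data.Nat.Properties
open import Algebra.Properties.CommutativeSemigroup *-commutativeSemigroup using (xy∙z≈xz∙y)
open import Data.Nat.DivMod using (_/_; _%_; _mod_; m%n<n; m%n%n≡m%n; %-distribˡ-*; m*n/n≡m; m*n%n≡0; 0/n≡0)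
open import Data.Nat.Divisibility using (_∣_; _∤_; divides; _∣?_; _∣0; ∣1⇒≡1; m%n≡0⇒n∣m)
open import Data.Nat.GCD using (gcd-greatest)
open import Data.Nat.Primality using (euclidsLemma; prime⇒nonTrivial)
open import Data.Fin using (toℕ) renaming (zero to fzero; suc to fsuc)
open import Data.Fin.Properties using (toℕ-fromℕ<; ¬∀⟶∃¬)
open import Data.Product using (_,_; proj₁; proj₂; ∃-syntax)
open import Data.Sum using ([_,_]′)
open import Function using (id)
open import Relation.Binary.PropositionalEquality using (refl; sym; trans; cong; subst; module ≡-Reasoning)
open import Relation.Nullary using (contradiction)

-- Along the line ℓ ↦ ℓq, the digit block of ℓq at every level lies in C, and it is
-- the zero block only when s ∣ ℓ (because s is prime and does not divide some q_j).
-- So if φ^n(a) had the letter a at ℓq with 0 < ℓ < s^n, unwinding one level of the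
-- iteration would either produce an a in some φ(b) at a forbidden position of C, or
-- force s ∣ ℓ and move the same situation to (ℓ/s)q at level n − 1, which is
-- eventually impossible.

toℕ-mod : ∀ m n .{{_ : NonZero n}} → toℕ (m mod n) ≡ m % n
toℕ-mod m n = toℕ-fromℕ< (m%n<n m n)

[m*n]%o≡[m%o*n]%o : ∀ m n o .{{_ : NonZero o}} → (m * n) % o ≡ (m % o * n) % o
[m*n]%o≡[m%o*n]%o m n o = begin
  (m * n) % o              ≡⟨ %-distribˡ-* m n o ⟩
  (m % o * (n % o)) % o    ≡⟨ cong (λ x → (x * (n % o)) % o) (sym (m%n%n≡m%n m o)) ⟩
  (m % o % o * (n % o)) % o ≡⟨ sym (%-distribˡ-* (m % o) n o) ⟩
  (m % o * n) % o          ∎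
  where open ≡-Reasoning

n<m^n : ∀ m n → 1 < m → n < m ^ n
n<m^n m zero    1<m = z<s
n<m^n m (suc n) 1<m = begin-strict
  suc n       ≤⟨ n<m^n m n 1<m ⟩
  m ^ n       <⟨ m<m*n (m ^ n) m {{>-nonZero (≤-<-trans z≤n (n<m^n m n 1<m))}} 1<m ⟩
  m ^ n * m   ≡⟨ *-comm (m ^ n) m ⟩
  m * m ^ n   ∎
  where open ≤-Reasoning

coord≤coordSum : ∀ {d} (i : Point d) j → i j ≤ coordSum i
coord≤coordSum i fzero    = m≤m+n _ _
coord≤coordSum i (fsuc j) = ≤-trans (coord≤coordSum (λ x → i (fsuc x)) j) (m≤n+m _ _)

coord<m^[1+coordSum] : ∀ {d} m → 1 < m → (i : Point d) (j : Fin d) → i j < m ^ suc (coordSum i)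
coord<m^[1+coordSum] m 1<m i j =
  <-≤-trans (s≤s (coord≤coordSum i j)) (<⇒≤ (n<m^n m (suc (coordSum i)) 1<m))

gcdAll-greatest : ∀ {d} (q : Point d) {c} → (∀ j → c ∣ q j) → c ∣ gcdAll q
gcdAll-greatest {zero}  q c∣q = _ ∣0
gcdAll-greatest {suc d} q c∣q =
  gcd-greatest (c∣q fzero) (gcdAll-greatest (λ x → q (fsuc x)) (λ j → c∣q (fsuc j)))

nonTrivial∤someCoordinate : ∀ {d} {q : Point d} s → .{{NonTrivial s}} → IsDirection q → ∃[ j ] s ∤ q j
nonTrivial∤someCoordinate {d} {q} s direction = ¬∀⟶∃¬ d (λ j → s ∣ q j) (λ j → s ∣? q j)
  (λ s∣q → nonTrivial⇒≢1 (∣1⇒≡1 (subst (s ∣_) direction (gcdAll-greatest q s∣q))))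

firstLetterUnique⇒¬Recurrent : ∀ {A : Set} (w : ℕ → A) → (∀ ℓ → 0 < ℓ → w ℓ ≢ w 0) → ¬ Recurrent w
firstLetterUnique⇒¬Recurrent w unique recurrent with recurrent 1
... | m , 0<m , prefixRepeats =
  unique m 0<m (trans (cong w (sym (+-identityʳ m))) (prefixRepeats 0 z<s))

OnLine : ∀ {d} → Point d → ℕ → Point d → Set
OnLine q ℓ p = ∀ j → p j ≡ ℓ * q j

module _ {d s : ℕ} .{{_ : NonZero s}} {q : Point d} where

  onLine-mod-inCyclic : ∀ {ℓ p} → OnLine q ℓ p → InCyclic q (λ j → p j mod s)
  onLine-mod-inCyclic {ℓ} {p} onLine = ℓ mod s , λ j → begin
    toℕ (p j mod s)            ≡⟨ toℕ-mod (p j) s ⟩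
    p j % s                    ≡⟨ cong (_% s) (onLine j) ⟩
    (ℓ * q j) % s              ≡⟨ [m*n]%o≡[m%o*n]%o ℓ (q j) s ⟩
    (ℓ % s * q j) % s          ≡⟨ cong (λ x → (x * q j) % s) (sym (toℕ-mod ℓ s)) ⟩
    (toℕ (ℓ mod s) * q j) % s  ∎
    where open ≡-Reasoning

  onLine-/ : ∀ {m p} → OnLine q (m * s) p → OnLine q m (λ j → p j / s)
  onLine-/ {m} {p} onLine j = begin
    p j / s          ≡⟨ cong (_/ s) (onLine j) ⟩
    m * s * q j / s  ≡⟨ cong (_/ s) (xy∙z≈xz∙y m s (q j)) ⟩
    m * q j * s / s  ≡⟨ m*n/n≡m (m * q j) s ⟩
    m * q j          ∎
    where open ≡-Reasoning

  onLine-zeroPos⇒∣ : ∀ {ℓ p j₀} → Prime s → s ∤ q j₀ →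
                     OnLine q ℓ p → IsZeroPos (λ j → p j mod s) → s ∣ ℓ
  onLine-zeroPos⇒∣ {ℓ} {p} {j₀} s-prime s∤q onLine zeroPos =
    [ id , (λ s∣q → contradiction s∣q s∤q) ]′
      (euclidsLemma ℓ (q j₀) s-prime (subst (s ∣_) (onLine j₀) s∣p))
    where
    s∣p : s ∣ p j₀
    s∣p = m%n≡0⇒n∣m (p j₀) s (trans (sym (toℕ-mod (p j₀) s)) (zeroPos j₀))

  onLine-descend : ∀ {ℓ p} n → s ∣ ℓ → OnLine q ℓ p → 0 < ℓ → ℓ < s ^ suc n →
                   ∃[ m ] OnLine q m (λ j → p j / s) × 0 < m × m < s ^ n
  onLine-descend n (divides m refl) onLine 0<ms ms<s^[1+n] =
    m , onLine-/ {m = m} onLine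
      , >-nonZero⁻¹ m {{m*n≢0⇒m≢0 m {{>-nonZero 0<ms}}}}
      , *-cancelʳ-< s m (s ^ n) (subst (m * s <_) (*-comm s (s ^ n)) ms<s^[1+n])

module _ {k d s : ℕ} .{{_ : NonZero s}} (φ : SquareMorphism (Fin k) d s) (a : Fin k) where

  iter-origin : (∀ i → IsZeroPos i → φ a i ≡ a) → ∀ n p → (∀ j → p j ≡ 0) → iter φ n a p ≡ a
  iter-origin prolongable zero    p p≡0 = refl
  iter-origin prolongable (suc n) p p≡0
    rewrite iter-origin prolongable n (λ j → p j / s) (λ j → trans (cong (_/ s) (p≡0 j)) (0/n≡0 s))
    = prolongable _ (λ j → trans (toℕ-mod (p j) s) (trans (cong (_% s) (p≡0 j)) (m*n%n≡0 0 s)))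

  iter-onLine-≢ : ∀ {q : Point d} {j₀} → Prime s → s ∤ q j₀ →
    (∀ (b : Fin k) (i : Fin d → Fin s) → InCyclic q i → ¬ (b ≡ a × IsZeroPos i) → φ b i ≢ a) →
    ∀ n {ℓ p} → OnLine q ℓ p → 0 < ℓ → ℓ < s ^ n → iter φ n a p ≢ a
  iter-onLine-≢ s-prime s∤q avoidsA zero    onLine 0<ℓ ℓ<1 = contradiction 0<ℓ (<⇒≱ ℓ<1)
  iter-onLine-≢ s-prime s∤q avoidsA (suc n) {ℓ} {p} onLine 0<ℓ ℓ<s^[1+n] =
    avoidsA _ _ (onLine-mod-inCyclic {ℓ = ℓ} onLine) parentNotOrigin
    where
    parentNotOrigin : ¬ (iter φ n a (λ j → p j / s) ≡ a × IsZeroPos (λ j → p j mod s))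
    parentNotOrigin (parent≡a , zeroPos)
      with onLine-descend n (onLine-zeroPos⇒∣ s-prime s∤q onLine zeroPos) onLine 0<ℓ ℓ<s^[1+n]
    ... | m , onLine′ , 0<m , m<s^n = iter-onLine-≢ s-prime s∤q avoidsA n onLine′ 0<m m<s^n parent≡a

proposition6p18 : (s : ℕ) .{{_ : NonZero s}} → Prime s →
    (d k : ℕ) (φ : SquareMorphism (Fin k) d s) (a : Fin k) →
    (∀ i → IsZeroPos i → φ a i ≡ a) →
    (q : Point d) → IsDirection q →
    (∀ (b : Fin k) (i : Fin d → Fin s) → InCyclic q i →
       ¬ (b ≡ a × IsZeroPos i) → φ b i ≢ a) →
    (phiOmega φ a (λ j → 0 * q j) ≡ a)
    × (∀ ℓ → 0 < ℓ → phiOmega φ a (λ j → ℓ * q j) ≢ a)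
    × ¬ Recurrent (λ ℓ → phiOmega φ a (λ j → ℓ * q j))
proposition6p18 s s-prime d k φ a prolongable q direction avoidsA = origin≡a , later≢a , notRecurrent
  where
  instance
    _ : NonTrivial s
    _ = prime⇒nonTrivial s-prime
  j₀ : Fin d
  j₀ = proj₁ (nonTrivial∤someCoordinate {q = q} s direction)
  s∤q : s ∤ q j₀
  s∤q = proj₂ (nonTrivial∤someCoordinate {q = q} s direction)
  instance
    _ : NonZero (q j₀)
    _ = ≢-nonZero (λ q≡0 → s∤q (subst (s ∣_) (sym q≡0) (s ∣0)))

  origin≡a : phiOmega φ a (λ j → 0 * q j) ≡ a
  origin≡a = iter-origin φ a prolongable (suc (coordSum (λ j → 0 * q j))) _ (λ j → refl)

  later≢a : ∀ ℓ → 0 < ℓ → phiOmega φ a (λ j → ℓ * q j) ≢ a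
  later≢a ℓ 0<ℓ =
    iter-onLine-≢ φ a s-prime s∤q avoidsA (suc (coordSum (λ j → ℓ * q j))) {ℓ} (λ j → refl) 0<ℓ
    (≤-<-trans (m≤m*n ℓ (q j₀)) (coord<m^[1+coordSum] s (nonTrivial⇒n>1 s) (λ j → ℓ * q j) j₀))

  notRecurrent : ¬ Recurrent (λ ℓ → phiOmega φ a (λ j → ℓ * q j))
  notRecurrent = firstLetterUnique⇒¬Recurrent _
    (λ ℓ 0<ℓ later≡origin → later≢a ℓ 0<ℓ (trans later≡origin origin≡a))
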